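{- For any permutations $\pi$, $\sigma$, we have $D(\pi \oplus \sigma) = D(\pi) \oplus D(\sigma)$ and $D(\pi \ominus \sigma) = D(\pi) \ominus D(\sigma)$.
   Context: A permutation of length $n\ge0$ is a bijection $\pi$ of $[n]$, written as $\pi(1)\ldots\pi(n)$. $\mathbb N=\{0,1,2,\dots\}$. For $r,s\in\mathbb N$, $\pi$ is $(r,s)$-coverable if its terms can be partitioned into $r$ increasing and $s$ decreasing (possibly empty) subsequences. $D(\pi)=\{(r,s)\in\mathbb N^2:\pi\text{ is not }(r,s)\text{ -coverable}\}$. For permutations $\pi$ of length $n$ and $\sigma$ of length $m$, the direct sum $\pi\oplus\sigma$ is the permutation of length $n+m$ given by $\pi(1)\ldots\pi(n),\ \sigma(1)+n\ldots\sigma(m)+n$, and the skew sum $\pi\ominus\sigma$ is given by $\pi(1)+m\ldots\pi(n)+m,\ \sigma(1)\ldots\sigma(m)$. For subsets $A,B\subseteq\mathbb N^2$, $A\oplus B$ is the set of $(r,s)\in\mathbb N^2$ such that for all $s_1,s_2\in\mathbb N$ with $s=s_1+s_2$, either $(r,s_1)\in A$ or $(r,s_2)\in B$; and $A\ominus B$ is the set of $(r,s)\in\mathbb N^2$ such that for all $r_1,r_2\in\mathbb N$ with $r=r_1+r_2$, either $(r_1,s)\in A$ or $(r_2,s)\in B$. -}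

module Defs where

open import Data.Nat using (ℕ; _+_)
open import Data.Nat.Properties using (+-comm)
open import Data.Fin using (Fin; _<_; _>_; splitAt; join; cast)
open import Data.Sum using (_⊎_; inj₁; inj₂; swap)
import Data.Sum as Sum
open import Data.Product using (_×_; _,_)
open import Relation.Binary.PropositionalEquality using (_≡_)
open import Relation.Nullary using (¬_)

-- A permutation of length n is given by its sequence of values,
-- i.e. a function Fin n → Fin n (position i ↦ value π(i)).
Seq : ℕ → Set
Seq n = Fin n → Fin n

-- Direct sum on underlying sequences: π(1)…π(n), σ(1)+n … σ(m)+n.
_⊕ₚ_ : ∀ {n m} → Seq n → Seq m → Seq (n + m)
_⊕ₚ_ {n} {m} π σ i = join n m (Sum.map π σ (splitAt n i))

-- Skew sum: π(1)+m … π(n)+m, σ(1) … σ(m).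
-- join m n (inj₂ v) = m + v (shift up by m), join m n (inj₁ w) = w.
_⊖ₚ_ : ∀ {n m} → Seq n → Seq m → Seq (n + m)
_⊖ₚ_ {n} {m} π σ i = cast (+-comm m n) (join m n (swap (Sum.map π σ (splitAt n i))))

-- π is (r,s)-coverable: the positions can be coloured by r "increasing"
-- colours and s "decreasing" colours so that each colour class is an
-- increasing (resp. decreasing) subsequence (classes may be empty).
Coverable : ∀ {n} → Seq n → ℕ → ℕ → Set
Coverable {n} π r s =
  Data.Product.Σ (Fin n → Fin r ⊎ Fin s) λ c →
    (∀ i j (k : Fin r) → c i ≡ inj₁ k → c j ≡ inj₁ k → i < j → π i < π j) ×
    (∀ i j (k : Fin s) → c i ≡ inj₂ k → c j ≡ inj₂ k → i < j → π i > π j)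

Subset² : Set₁
Subset² = ℕ → ℕ → Set

D : ∀ {n} → Seq n → Subset²
D π r s = ¬ Coverable π r s

_⊕ˢ_ : Subset² → Subset² → Subset²
(A ⊕ˢ B) r s = ∀ s₁ s₂ → s ≡ s₁ + s₂ → A r s₁ ⊎ B r s₂

_⊖ˢ_ : Subset² → Subset² → Subset²
(A ⊖ˢ B) r s = ∀ r₁ r₂ → r ≡ r₁ + r₂ → A r₁ s ⊎ B r₂ s

_≐_ : Subset² → Subset² → Set
A ≐ B = ∀ r s → (A r s → B r s) × (B r s → A r s)

-- Every entry of the π-block lies below and to the left of every entry of
-- the σ-block, so an increasing class may freely run through both blocks,
-- while a decreasing class meets only one of them. Hence a covering of π ⊕ σ
-- is the same thing as coverings of π and of σ sharing the r increasing
-- colours and dividing the s decreasing ones; the skew sum is the same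
-- statement with the roles of increasing and decreasing exchanged.
module Submission where

open import Defs
open import Data.Nat using (ℕ)
open import Data.Product using (_×_)
open import Data.Fin.Permutation using (Permutation′; _⟨$⟩ʳ_)

import Data.Nat as ℕ
open import Data.Nat using (zero; suc; _+_)
open import Data.Nat.Properties
  using (+-suc; +-monoʳ-<; +-cancelˡ-<; m≤m+n; <-≤-trans; <-irrefl)
open import Data.Fin using (Fin; zero; suc; toℕ; _↑ˡ_; _↑ʳ_; join; _<_; _>_)
open import Data.Fin.Properties
  using (toℕ-↑ˡ; toℕ-↑ʳ; ↑ˡ-injective; ↑ʳ-injective; splitAt-↑ˡ; splitAt-↑ʳ;
         toℕ-cast; toℕ<n; suc-injective; any?; all?; _<?_; _≟_; <-asym)
open import Data.Vec.Functional using (_∷_; _++_; head; tail)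
open import Data.Vec.Functional.Properties using (lookup-++ˡ; lookup-++ʳ)
open import Data.Sum using (_⊎_; inj₁; inj₂; swap; [_,_]′; map₂)
import Data.Sum as Sum
open import Data.Sum.Properties using (inj₂-injective; swap-involutive; ≡-dec)
open import Data.Product using (Σ; ∃; ∃₂; ∃-syntax; _,_; proj₁; proj₂)
open import Data.Empty using (⊥; ⊥-elim)
open import Function using (_∘_; flip)
import Level
open import Level using (0ℓ)
open import Relation.Binary using (Rel; Setoid; IsEquivalence)
import Relation.Binary as B
open import Relation.Binary.PropositionalEquality
  using (_≡_; _≢_; refl; sym; trans; cong; subst; subst₂; _≗_)
open import Relation.Unary using (Pred)
import Relation.Unary as U
open import Relation.Unary.Properties using (∁?)
open import Relation.Nullary using (¬_; Dec; yes; no)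
open import Relation.Nullary.Decidable using (map′; _×-dec_; _→-dec_; _⊎-dec_)

private
  variable
    A : Set
    k n m a b b′ : ℕ

↑ˡ-mono-< : ∀ {i j : Fin n} → i < j → i ↑ˡ m < j ↑ˡ m
↑ˡ-mono-< {m = m} {i} {j} = subst₂ ℕ._<_ (sym (toℕ-↑ˡ i m)) (sym (toℕ-↑ˡ j m))

↑ˡ-cancel-< : ∀ {i j : Fin n} → i ↑ˡ m < j ↑ˡ m → i < j
↑ˡ-cancel-< {m = m} {i} {j} = subst₂ ℕ._<_ (toℕ-↑ˡ i m) (toℕ-↑ˡ j m)

↑ʳ-mono-< : ∀ {i j : Fin m} → i < j → n ↑ʳ i < n ↑ʳ j
↑ʳ-mono-< {n = n} {i} {j} i<j =
  subst₂ ℕ._<_ (sym (toℕ-↑ʳ n i)) (sym (toℕ-↑ʳ n j)) (+-monoʳ-< n i<j)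

↑ʳ-cancel-< : ∀ {i j : Fin m} → n ↑ʳ i < n ↑ʳ j → i < j
↑ʳ-cancel-< {n = n} {i} {j} lt =
  +-cancelˡ-< n _ _ (subst₂ ℕ._<_ (toℕ-↑ʳ n i) (toℕ-↑ʳ n j) lt)

↑ˡ<↑ʳ : ∀ (i : Fin n) (j : Fin m) → i ↑ˡ m < n ↑ʳ j
↑ˡ<↑ʳ {n} {m} i j = subst₂ ℕ._<_ (sym (toℕ-↑ˡ i m)) (sym (toℕ-↑ʳ n j))
  (<-≤-trans (toℕ<n i) (m≤m+n n (toℕ j)))

↑ˡ≢↑ʳ : ∀ (i : Fin n) (j : Fin m) → i ↑ˡ m ≢ n ↑ʳ j
↑ˡ≢↑ʳ i j eq = <-irrefl (cong toℕ eq) (↑ˡ<↑ʳ i j)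

data Block (n m : ℕ) : Fin (n + m) → Set where
  inLeft  : (i : Fin n) → Block n m (i ↑ˡ m)
  inRight : (j : Fin m) → Block n m (n ↑ʳ j)

block : ∀ n (p : Fin (n + m)) → Block n m p
block zero    p       = inRight p
block (suc n) zero    = inLeft zero
block (suc n) (suc p) with block n p
... | inLeft i  = inLeft (suc i)
... | inRight j = inRight j

blocks-ordered : ∀ {ℓ} (T : Rel (Fin (n + m)) ℓ) →
  (∀ i j → i < j → T (i ↑ˡ m) (j ↑ˡ m)) →
  (∀ i j → i < j → T (n ↑ʳ i) (n ↑ʳ j)) →
  (∀ i j → T (i ↑ˡ m) (n ↑ʳ j)) →
  ∀ p q → p < q → T p q
blocks-ordered {n} T left right cross p q p<q with block n p | block n q
... | inLeft i  | inLeft j  = left i j (↑ˡ-cancel-< p<q)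
... | inRight i | inRight j = right i j (↑ʳ-cancel-< p<q)
... | inLeft i  | inRight j = cross i j
... | inRight i | inLeft j  = ⊥-elim (<-asym p<q (↑ˡ<↑ʳ j i))

Colouring : ℕ → ℕ → ℕ → Set
Colouring k a b = Fin k → Fin a ⊎ Fin b

Finer : Colouring k a b′ → Colouring k a b → Set
Finer c′ c =
  (∀ i x → c′ i ≡ inj₁ x → c i ≡ inj₁ x) ×
  (∀ i j y → c′ i ≡ inj₂ y → c′ j ≡ inj₂ y → ∃[ x ] c i ≡ inj₂ x × c j ≡ inj₂ x)

Finer-≗ : {c′ c : Colouring k a b} → c′ ≗ c → Finer c′ c
Finer-≗ eq = (λ i x e → trans (sym (eq i)) e) ,
             (λ i j y e e′ → y , trans (sym (eq i)) e , trans (sym (eq j)) e′)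

Finer-map₂ : {ρ : Fin b → Fin b′} → (∀ {y z} → ρ y ≡ ρ z → y ≡ z) →
  (c : Colouring k a b) → Finer (map₂ ρ ∘ c) c
Finer-map₂ {ρ = ρ} ρ-injective c = keep₁ , keep₂
  where
  keep₁ : ∀ i x → map₂ ρ (c i) ≡ inj₁ x → c i ≡ inj₁ x
  keep₁ i x e with c i
  keep₁ i x refl | inj₁ _ = refl
  keep₂ : ∀ i j z → map₂ ρ (c i) ≡ inj₂ z → map₂ ρ (c j) ≡ inj₂ z →
    ∃[ y ] c i ≡ inj₂ y × c j ≡ inj₂ y
  keep₂ i j z e e′ with c i | c j
  keep₂ i j z refl e′ | inj₂ y | inj₂ y′ =
    y , refl , cong inj₂ (ρ-injective (inj₂-injective e′))

module _ {Q : Pred (Fin b) 0ℓ} (ρ : ∀ y → Q y → Fin b′) where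

  relabel : (w : Fin a ⊎ Fin b) → (∀ y → w ≡ inj₂ y → Q y) → Fin a ⊎ Fin b′
  relabel (inj₁ x) _    = inj₁ x
  relabel (inj₂ y) used = inj₂ (ρ y (used y refl))

  relabel-inj₁ : ∀ (w : Fin a ⊎ Fin b) used {x} → relabel w used ≡ inj₁ x → w ≡ inj₁ x
  relabel-inj₁ (inj₁ x) _ refl = refl

  relabel-inj₂ : (∀ y z q q′ → ρ y q ≡ ρ z q′ → y ≡ z) →
    ∀ (w w′ : Fin a ⊎ Fin b) used used′ {z} →
    relabel w used ≡ inj₂ z → relabel w′ used′ ≡ inj₂ z → ∃[ y ] w ≡ inj₂ y × w′ ≡ inj₂ y
  relabel-inj₂ ρ-injective (inj₂ y) (inj₂ y′) used used′ refl e =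
    y , refl , cong inj₂ (ρ-injective _ _ _ _ (inj₂-injective e))

  Finer-relabel : (∀ y z q q′ → ρ y q ≡ ρ z q′ → y ≡ z) →
    (c : Colouring k a b) (used : ∀ i y → c i ≡ inj₂ y → Q y) →
    Finer (λ i → relabel (c i) (used i)) c
  Finer-relabel ρ-injective c used =
    (λ i x → relabel-inj₁ (c i) (used i)) ,
    (λ i j y → relabel-inj₂ ρ-injective (c i) (c j) (used i) (used j))

count : {P : Pred (Fin b) 0ℓ} → U.Decidable P → ℕ
count {zero}  P? = 0
count {suc b} P? with P? zero
... | yes _ = suc (count (P? ∘ suc))
... | no _  = count (P? ∘ suc)

rank : {P : Pred (Fin b) 0ℓ} (P? : U.Decidable P) → ∀ y → P y → Fin (count P?)
rank {suc b} P? y p with P? zero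
rank P? zero    p | yes _  = zero
rank P? (suc y) p | yes _  = suc (rank (P? ∘ suc) y p)
rank P? zero    p | no ¬p₀ = ⊥-elim (¬p₀ p)
rank P? (suc y) p | no _   = rank (P? ∘ suc) y p

rank-injective : {P : Pred (Fin b) 0ℓ} (P? : U.Decidable P) →
  ∀ y z p q → rank P? y p ≡ rank P? z q → y ≡ z
rank-injective {suc b} P? y z p q eq with P? zero
rank-injective P? zero    zero    p q eq  | yes _ = refl
rank-injective P? (suc y) (suc z) p q eq  | yes _ =
  cong suc (rank-injective (P? ∘ suc) y z p q (suc-injective eq))
rank-injective P? zero    _       p q eq  | no ¬p₀ = ⊥-elim (¬p₀ p)
rank-injective P? (suc y) zero    p q eq  | no ¬p₀ = ⊥-elim (¬p₀ q)
rank-injective P? (suc y) (suc z) p q eq  | no _ =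
  cong suc (rank-injective (P? ∘ suc) y z p q eq)

count+count-∁ : {P : Pred (Fin b) 0ℓ} (P? : U.Decidable P) → count P? + count (∁? P?) ≡ b
count+count-∁ {zero}  P? = refl
count+count-∁ {suc b} P? with P? zero
... | yes _ = cong suc (count+count-∁ (P? ∘ suc))
... | no _  = trans (+-suc (count (P? ∘ suc)) _) (cong suc (count+count-∁ (P? ∘ suc)))

any-⊎? : ∀ {ℓ} {Q : Pred (Fin a ⊎ Fin b) ℓ} → U.Decidable Q → Dec (∃ Q)
any-⊎? Q? = map′ [ (λ (x , q) → inj₁ x , q) , (λ (y , q) → inj₂ y , q) ]′ split
  (any? (Q? ∘ inj₁) ⊎-dec any? (Q? ∘ inj₂))
  where
  split : ∃ _ → ∃ _ ⊎ ∃ _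
  split (inj₁ x , q) = inj₁ (x , q)
  split (inj₂ y , q) = inj₂ (y , q)

any-function? : ∀ {ℓ} {C : Set} → (∀ {Q : Pred C ℓ} → U.Decidable Q → Dec (∃ Q)) →
  {P : Pred (Fin k → C) ℓ} → (∀ {f g} → f ≗ g → P f → P g) → U.Decidable P → Dec (∃ P)
any-function? {zero} {C = C} search {P} resp P? =
  map′ (λ p → empty , p) (λ (f , p) → resp {f} {empty} (λ ()) p) (P? empty)
  where
  empty : Fin 0 → C
  empty ()
any-function? {suc k} search resp P? =
  map′ (λ (x , f , p) → x ∷ f , p)
       (λ (f , p) → head f , tail f , resp (λ { zero → refl ; (suc i) → refl }) p)
       (search λ x → any-function? search (λ f≗g → resp (λ { zero → refl ; (suc i) → f≗g i }))
                                           (λ f → P? (x ∷ f)))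

-- Defs.Coverable π is CoverableBy _<_ _>_ π; the skew sum is handled with
-- the relations exchanged, R, S = _>_, _<_.
module Coverings (R S : Rel A 0ℓ) where

  ValidColouring : (Fin k → A) → Colouring k a b → Set
  ValidColouring {a = a} {b = b} h c =
    (∀ i j (x : Fin a) → c i ≡ inj₁ x → c j ≡ inj₁ x → i < j → R (h i) (h j)) ×
    (∀ i j (y : Fin b) → c i ≡ inj₂ y → c j ≡ inj₂ y → i < j → S (h i) (h j))

  CoverableBy : (Fin k → A) → ℕ → ℕ → Set
  CoverableBy {k} h a b = Σ (Colouring k a b) (ValidColouring h)

  NotCoverableBy : (Fin k → A) → Subset²
  NotCoverableBy h a b = ¬ CoverableBy h a b

  ValidColouring-finer : {h : Fin k → A} {c′ : Colouring k a b′} {c : Colouring k a b} →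
    Finer c′ c → ValidColouring h c → ValidColouring h c′
  ValidColouring-finer (keep₁ , keep₂) (inc , dec) =
    (λ i j x e e′ → inc i j x (keep₁ i x e) (keep₁ j x e′)) ,
    (λ i j y e e′ → let x , ex , ex′ = keep₂ i j y e e′ in dec i j x ex ex′)

  ValidColouring-∘ : {h : Fin k → A} {c : Colouring k a b} (e : Fin n → Fin k) →
    (∀ {i j} → i < j → e i < e j) →
    ValidColouring h c → ValidColouring (h ∘ e) (c ∘ e)
  ValidColouring-∘ e e-mono (inc , dec) =
    (λ i j x ei ej i<j → inc (e i) (e j) x ei ej (e-mono i<j)) ,
    (λ i j y ei ej i<j → dec (e i) (e j) y ei ej (e-mono i<j))

  ValidColouring-++ : {τ : Fin (n + m) → A} {cₗ : Colouring n a b} {cᵣ : Colouring m a b} →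
    ValidColouring (τ ∘ (_↑ˡ m)) cₗ → ValidColouring (τ ∘ (n ↑ʳ_)) cᵣ →
    (∀ i j x → cₗ i ≡ inj₁ x → cᵣ j ≡ inj₁ x → R (τ (i ↑ˡ m)) (τ (n ↑ʳ j))) →
    (∀ i j y → cₗ i ≡ inj₂ y → cᵣ j ≡ inj₂ y → S (τ (i ↑ˡ m)) (τ (n ↑ʳ j))) →
    ValidColouring τ (cₗ ++ cᵣ)
  ValidColouring-++ {n = n} {m} {a} {b} {τ} {cₗ} {cᵣ} (incₗ , decₗ) (incᵣ , decᵣ) across₁ across₂ =
    ordered inj₁ R incₗ incᵣ across₁ , ordered inj₂ S decₗ decᵣ across₂
    where
    c : Colouring (n + m) a b
    c = cₗ ++ cᵣ
    ordered : ∀ {C : Set} (colour : C → Fin a ⊎ Fin b) (T : Rel A 0ℓ) →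
      (∀ i j x → cₗ i ≡ colour x → cₗ j ≡ colour x → i < j → T (τ (i ↑ˡ m)) (τ (j ↑ˡ m))) →
      (∀ i j x → cᵣ i ≡ colour x → cᵣ j ≡ colour x → i < j → T (τ (n ↑ʳ i)) (τ (n ↑ʳ j))) →
      (∀ i j x → cₗ i ≡ colour x → cᵣ j ≡ colour x → T (τ (i ↑ˡ m)) (τ (n ↑ʳ j))) →
      ∀ p q x → c p ≡ colour x → c q ≡ colour x → p < q → T (τ p) (τ q)
    ordered colour T left right across p q x cp cq p<q =
      blocks-ordered (λ p q → c p ≡ colour x → c q ≡ colour x → T (τ p) (τ q))
        (λ i j i<j cᵢ cⱼ → left i j x (atₗ i cᵢ) (atₗ j cⱼ) i<j)
        (λ i j i<j cᵢ cⱼ → right i j x (atᵣ i cᵢ) (atᵣ j cⱼ) i<j)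
        (λ i j cᵢ cⱼ → across i j x (atₗ i cᵢ) (atᵣ j cⱼ))
        p q p<q cp cq
      where
      atₗ : ∀ i {w} → c (i ↑ˡ m) ≡ w → cₗ i ≡ w
      atₗ i = trans (sym (lookup-++ˡ cₗ cᵣ i))
      atᵣ : ∀ j {w} → c (n ↑ʳ j) ≡ w → cᵣ j ≡ w
      atᵣ j = trans (sym (lookup-++ʳ cₗ cᵣ j))

  CoverableBy-relabel : {h : Fin k → A} {c : Colouring k a b} {Q : Pred (Fin b) 0ℓ} →
    (ρ : ∀ y → Q y → Fin b′) → (∀ y z q q′ → ρ y q ≡ ρ z q′ → y ≡ z) →
    (used : ∀ i y → c i ≡ inj₂ y → Q y) →
    ValidColouring h c → CoverableBy h a b′
  CoverableBy-relabel {c = c} ρ ρ-injective used valid =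
    (λ i → relabel ρ (c i) (used i)) ,
    ValidColouring-finer (Finer-relabel ρ ρ-injective c used) valid

  validColouring? : B.Decidable R → B.Decidable S →
    (h : Fin k → A) (c : Colouring k a b) → Dec (ValidColouring h c)
  validColouring? R? S? h c =
    (all? λ i → all? λ j → all? λ x →
      ≡-dec _≟_ _≟_ (c i) (inj₁ x) →-dec ≡-dec _≟_ _≟_ (c j) (inj₁ x) →-dec
      i <? j →-dec R? (h i) (h j))
    ×-dec
    (all? λ i → all? λ j → all? λ y →
      ≡-dec _≟_ _≟_ (c i) (inj₂ y) →-dec ≡-dec _≟_ _≟_ (c j) (inj₂ y) →-dec
      i <? j →-dec S? (h i) (h j))

  coverableBy? : B.Decidable R → B.Decidable S →
    (h : Fin k → A) → ∀ a b → Dec (CoverableBy h a b)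
  coverableBy? R? S? h a b = any-function? any-⊎?
    (λ c≗c′ → ValidColouring-finer (Finer-≗ (sym ∘ c≗c′))) (validColouring? R? S? h)

  module _ {τ : Fin (n + m) → A} where

    CoverableBy-++ : (∀ i j → R (τ (i ↑ˡ m)) (τ (n ↑ʳ j))) →
      CoverableBy (τ ∘ (_↑ˡ m)) a b → CoverableBy (τ ∘ (n ↑ʳ_)) a b′ →
      CoverableBy τ a (b + b′)
    CoverableBy-++ {a = a} {b} {b′} R-across (cₗ , validₗ) (cᵣ , validᵣ) =
      map₂ (_↑ˡ b′) ∘ cₗ ++ map₂ (b ↑ʳ_) ∘ cᵣ ,
      ValidColouring-++
        (ValidColouring-finer (Finer-map₂ (↑ˡ-injective b′ _ _) cₗ) validₗ)
        (ValidColouring-finer (Finer-map₂ (↑ʳ-injective b _ _) cᵣ) validᵣ)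
        (λ i j _ _ _ → R-across i j)
        (λ i j _ eₗ eᵣ → ⊥-elim (colours-disjoint (cₗ i) (cᵣ j) eₗ eᵣ))
      where
      colours-disjoint : ∀ (w : Fin a ⊎ Fin b) (w′ : Fin a ⊎ Fin b′) {z} →
        map₂ (_↑ˡ b′) w ≡ inj₂ z → map₂ (b ↑ʳ_) w′ ≡ inj₂ z → ⊥
      colours-disjoint (inj₂ y) (inj₂ y′) refl e = ↑ˡ≢↑ʳ y y′ (sym (inj₂-injective e))

    -- A decreasing colour met in the left block cannot reappear in the right
    -- block, so the colours met on the left and the remaining ones, each
    -- ranked separately, share out the b decreasing colours.
    CoverableBy-split : (∀ i j → ¬ S (τ (i ↑ˡ m)) (τ (n ↑ʳ j))) →
      CoverableBy τ a b →
      ∃₂ λ b₁ b₂ → b ≡ b₁ + b₂ ×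
        CoverableBy (τ ∘ (_↑ˡ m)) a b₁ × CoverableBy (τ ∘ (n ↑ʳ_)) a b₂
    CoverableBy-split {b = b} S-across (c , valid) =
      count usedLeft? , count (∁? usedLeft?) , sym (count+count-∁ usedLeft?) ,
      CoverableBy-relabel (rank usedLeft?) (rank-injective usedLeft?) (λ i y e → i , e)
        (ValidColouring-∘ (_↑ˡ m) ↑ˡ-mono-< valid) ,
      CoverableBy-relabel (rank (∁? usedLeft?)) (rank-injective (∁? usedLeft?)) notUsedLeft
        (ValidColouring-∘ (n ↑ʳ_) ↑ʳ-mono-< valid)
      where
      UsedLeft : Pred (Fin b) 0ℓ
      UsedLeft y = ∃[ i ] c (i ↑ˡ m) ≡ inj₂ y
      usedLeft? : U.Decidable UsedLeft
      usedLeft? y = any? λ i → ≡-dec _≟_ _≟_ (c (i ↑ˡ m)) (inj₂ y)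
      notUsedLeft : ∀ j y → c (n ↑ʳ j) ≡ inj₂ y → ¬ UsedLeft y
      notUsedLeft j y eᵣ (i , eₗ) = S-across i j (proj₂ valid _ _ y eₗ eᵣ (↑ˡ<↑ʳ i j))

    -- Decidability of coverability is what lets a non-coverable τ choose, at
    -- each split b₁ + b₂, which of its two blocks fails.
    NotCoverableBy-++ : B.Decidable R → B.Decidable S →
      (∀ i j → R (τ (i ↑ˡ m)) (τ (n ↑ʳ j))) → (∀ i j → ¬ S (τ (i ↑ˡ m)) (τ (n ↑ʳ j))) →
      NotCoverableBy τ ≐ (NotCoverableBy (τ ∘ (_↑ˡ m)) ⊕ˢ NotCoverableBy (τ ∘ (n ↑ʳ_)))
    NotCoverableBy-++ R? S? R-across S-across a b = to , from
      where
      to : NotCoverableBy τ a b →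
        (NotCoverableBy (τ ∘ (_↑ˡ m)) ⊕ˢ NotCoverableBy (τ ∘ (n ↑ʳ_))) a b
      to ¬cover b₁ b₂ eq with coverableBy? R? S? (τ ∘ (_↑ˡ m)) a b₁
      ... | yes coverₗ = inj₂ λ coverᵣ →
              ¬cover (subst (CoverableBy τ a) (sym eq) (CoverableBy-++ R-across coverₗ coverᵣ))
      ... | no ¬coverₗ = inj₁ ¬coverₗ
      from : (NotCoverableBy (τ ∘ (_↑ˡ m)) ⊕ˢ NotCoverableBy (τ ∘ (n ↑ʳ_))) a b →
        NotCoverableBy τ a b
      from split cover with CoverableBy-split S-across cover
      ... | b₁ , b₂ , eq , coverₗ , coverᵣ =
        [ (λ ¬coverₗ → ¬coverₗ coverₗ) , (λ ¬coverᵣ → ¬coverᵣ coverᵣ) ]′ (split b₁ b₂ eq)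

infix 25 _ᵀ

_ᵀ : Subset² → Subset²
(X ᵀ) r s = X s r

≐-isEquivalence : IsEquivalence _≐_
≐-isEquivalence = record
  { refl  = λ r s → (λ x → x) , (λ x → x)
  ; sym   = λ X≐Y r s → proj₂ (X≐Y r s) , proj₁ (X≐Y r s)
  ; trans = λ X≐Y Y≐Z r s → proj₁ (Y≐Z r s) ∘ proj₁ (X≐Y r s) , proj₂ (X≐Y r s) ∘ proj₂ (Y≐Z r s)
  }

≐-setoid : Setoid (Level.suc 0ℓ) 0ℓ
≐-setoid = record { isEquivalence = ≐-isEquivalence }

open IsEquivalence ≐-isEquivalence using () renaming (trans to ≐-trans)

ᵀ-cong : ∀ {X Y} → X ≐ Y → X ᵀ ≐ Y ᵀ
ᵀ-cong X≐Y r s = X≐Y s r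

⊕ˢ-cong : ∀ {X X′ Y Y′} → X ≐ X′ → Y ≐ Y′ → (X ⊕ˢ Y) ≐ (X′ ⊕ˢ Y′)
⊕ˢ-cong X≐X′ Y≐Y′ r s =
  (λ split s₁ s₂ eq → Sum.map (proj₁ (X≐X′ r s₁)) (proj₁ (Y≐Y′ r s₂)) (split s₁ s₂ eq)) ,
  (λ split s₁ s₂ eq → Sum.map (proj₂ (X≐X′ r s₁)) (proj₂ (Y≐Y′ r s₂)) (split s₁ s₂ eq))

module _ {h : Fin k → A} where
  open Coverings

  CoverableBy-swap : ∀ (R S : Rel A 0ℓ) → CoverableBy R S h a b → CoverableBy S R h b a
  CoverableBy-swap R S (c , inc , dec) = swap ∘ c ,
    (λ i j x e e′ → dec i j x (swap-inj (c i) e) (swap-inj (c j) e′)) ,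
    (λ i j y e e′ → inc i j y (swap-inj (c i) e) (swap-inj (c j) e′))
    where
    swap-inj : ∀ {X Y : Set} (w : X ⊎ Y) {z} → swap w ≡ z → w ≡ swap z
    swap-inj w e = trans (sym (swap-involutive w)) (cong swap e)

  NotCoverableBy-swap : ∀ (R S : Rel A 0ℓ) → NotCoverableBy R S h ≐ (NotCoverableBy S R h) ᵀ
  NotCoverableBy-swap R S a b =
    (λ ¬cover → ¬cover ∘ CoverableBy-swap S R) , (λ ¬cover → ¬cover ∘ CoverableBy-swap R S)

module _ {p p′} {h : Fin k → Fin p} {h′ : Fin k → Fin p′}
         (d : ℕ) (shifted : ∀ i → toℕ (h′ i) ≡ d + toℕ (h i)) where
  open Coverings

  NotCoverableBy-shift : NotCoverableBy _<_ _>_ h′ ≐ NotCoverableBy _<_ _>_ h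
  NotCoverableBy-shift a b =
    (λ ¬cover → ¬cover ∘ transport shift) , (λ ¬cover → ¬cover ∘ transport unshift)
    where
    shift : ∀ i j → h i < h j → h′ i < h′ j
    shift i j lt = subst₂ ℕ._<_ (sym (shifted i)) (sym (shifted j)) (+-monoʳ-< d lt)
    unshift : ∀ i j → h′ i < h′ j → h i < h j
    unshift i j lt = +-cancelˡ-< d _ _ (subst₂ ℕ._<_ (shifted i) (shifted j) lt)
    transport : ∀ {q q′} {g : Fin k → Fin q} {g′ : Fin k → Fin q′} →
      (∀ i j → g i < g j → g′ i < g′ j) → CoverableBy _<_ _>_ g a b → CoverableBy _<_ _>_ g′ a b
    transport mono (c , inc , dec) = c ,
      (λ i j x e e′ i<j → mono i j (inc i j x e e′ i<j)) ,
      (λ i j y e e′ i<j → mono j i (dec i j y e e′ i<j))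

below-offset : ∀ {d} (x : Fin d) y → toℕ x ℕ.< d + y
below-offset {d} x y = <-≤-trans (toℕ<n x) (m≤m+n d y)

module _ (π : Seq n) (σ : Seq m) where
  open Coverings
  open import Relation.Binary.Reasoning.Setoid ≐-setoid

  toℕ-⊕ₚ-↑ˡ : ∀ i → toℕ ((π ⊕ₚ σ) (i ↑ˡ m)) ≡ toℕ (π i)
  toℕ-⊕ₚ-↑ˡ i = trans (cong (toℕ ∘ join n m ∘ Sum.map π σ) (splitAt-↑ˡ n i m)) (toℕ-↑ˡ (π i) m)

  toℕ-⊕ₚ-↑ʳ : ∀ j → toℕ ((π ⊕ₚ σ) (n ↑ʳ j)) ≡ n + toℕ (σ j)
  toℕ-⊕ₚ-↑ʳ j = trans (cong (toℕ ∘ join n m ∘ Sum.map π σ) (splitAt-↑ʳ n m j)) (toℕ-↑ʳ n (σ j))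

  toℕ-⊖ₚ-↑ˡ : ∀ i → toℕ ((π ⊖ₚ σ) (i ↑ˡ m)) ≡ m + toℕ (π i)
  toℕ-⊖ₚ-↑ˡ i = trans (toℕ-cast _ _)
    (trans (cong (toℕ ∘ join m n ∘ swap ∘ Sum.map π σ) (splitAt-↑ˡ n i m)) (toℕ-↑ʳ m (π i)))

  toℕ-⊖ₚ-↑ʳ : ∀ j → toℕ ((π ⊖ₚ σ) (n ↑ʳ j)) ≡ toℕ (σ j)
  toℕ-⊖ₚ-↑ʳ j = trans (toℕ-cast _ _)
    (trans (cong (toℕ ∘ join m n ∘ swap ∘ Sum.map π σ) (splitAt-↑ʳ n m j)) (toℕ-↑ˡ (σ j) n))

  ⊕ₚ-↑ˡ<↑ʳ : ∀ i j → (π ⊕ₚ σ) (i ↑ˡ m) < (π ⊕ₚ σ) (n ↑ʳ j)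
  ⊕ₚ-↑ˡ<↑ʳ i j = subst₂ ℕ._<_ (sym (toℕ-⊕ₚ-↑ˡ i)) (sym (toℕ-⊕ₚ-↑ʳ j)) (below-offset (π i) _)

  ⊖ₚ-↑ˡ>↑ʳ : ∀ i j → (π ⊖ₚ σ) (i ↑ˡ m) > (π ⊖ₚ σ) (n ↑ʳ j)
  ⊖ₚ-↑ˡ>↑ʳ i j = subst₂ ℕ._<_ (sym (toℕ-⊖ₚ-↑ʳ j)) (sym (toℕ-⊖ₚ-↑ˡ i)) (below-offset (σ j) _)

  D-⊕ₚ : D (π ⊕ₚ σ) ≐ (D π ⊕ˢ D σ)
  D-⊕ₚ = begin
    D (π ⊕ₚ σ)
      ≈⟨ NotCoverableBy-++ _<_ _>_ _<?_ (flip _<?_) ⊕ₚ-↑ˡ<↑ʳ (λ i j → <-asym (⊕ₚ-↑ˡ<↑ʳ i j)) ⟩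
    NotCoverableBy _<_ _>_ ((π ⊕ₚ σ) ∘ (_↑ˡ m)) ⊕ˢ NotCoverableBy _<_ _>_ ((π ⊕ₚ σ) ∘ (n ↑ʳ_))
      ≈⟨ ⊕ˢ-cong (NotCoverableBy-shift 0 toℕ-⊕ₚ-↑ˡ) (NotCoverableBy-shift n toℕ-⊕ₚ-↑ʳ) ⟩
    D π ⊕ˢ D σ ∎

  D-⊖ₚ : D (π ⊖ₚ σ) ≐ (D π ⊖ˢ D σ)
  D-⊖ₚ = begin
    D (π ⊖ₚ σ)
      ≈⟨ NotCoverableBy-swap _<_ _>_ ⟩
    NotCoverableBy _>_ _<_ (π ⊖ₚ σ) ᵀ
      ≈⟨ ᵀ-cong (NotCoverableBy-++ _>_ _<_ (flip _<?_) _<?_ ⊖ₚ-↑ˡ>↑ʳ (λ i j → <-asym (⊖ₚ-↑ˡ>↑ʳ i j))) ⟩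
    (NotCoverableBy _>_ _<_ ((π ⊖ₚ σ) ∘ (_↑ˡ m)) ⊕ˢ NotCoverableBy _>_ _<_ ((π ⊖ₚ σ) ∘ (n ↑ʳ_))) ᵀ
      ≈⟨ ᵀ-cong (⊕ˢ-cong (transposed-shift m toℕ-⊖ₚ-↑ˡ) (transposed-shift 0 toℕ-⊖ₚ-↑ʳ)) ⟩
    (D π ᵀ ⊕ˢ D σ ᵀ) ᵀ
      ≡⟨⟩
    D π ⊖ˢ D σ ∎
    where
    transposed-shift : ∀ {k p} {h′ : Fin k → Fin (n + m)} {h : Fin k → Fin p} d →
      (∀ i → toℕ (h′ i) ≡ d + toℕ (h i)) →
      NotCoverableBy _>_ _<_ h′ ≐ NotCoverableBy _<_ _>_ h ᵀ
    transposed-shift d shifted =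
      ≐-trans (NotCoverableBy-swap _>_ _<_) (ᵀ-cong (NotCoverableBy-shift d shifted))

lemma4 : ∀ {n m} (π : Permutation′ n) (σ : Permutation′ m) →
    (D ((π ⟨$⟩ʳ_) ⊕ₚ (σ ⟨$⟩ʳ_)) ≐ (D (π ⟨$⟩ʳ_) ⊕ˢ D (σ ⟨$⟩ʳ_))) ×
    (D ((π ⟨$⟩ʳ_) ⊖ₚ (σ ⟨$⟩ʳ_)) ≐ (D (π ⟨$⟩ʳ_) ⊖ˢ D (σ ⟨$⟩ʳ_)))
lemma4 π σ = D-⊕ₚ (π ⟨$⟩ʳ_) (σ ⟨$⟩ʳ_) , D-⊖ₚ (π ⟨$⟩ʳ_) (σ ⟨$⟩ʳ_)
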